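{- Let $x\in\mathrm{Tam}(B_n)$ and let $k\ge 2$ be such that $\mathrm{half}_k(x)$ exists. Then the smallest entry of $\mathrm{half}_k(x)$ is greater than the largest entry of $\mathrm{half}_{k-1}(x)$.
   Context: $B_n$ is the set of permutations $x=x_1\cdots x_{2n}$ of $\{1,\dots,2n\}$ with $x_i+x_{2n+1-i}=2n+1$ for all $i$. $x\in B_n$ contains a $312^*$ pattern if there are $i<j<k$ with $x_j<x_k<x_i$ and $x_k\ge n+1$; $\mathrm{Tam}(B_n)$ is the set of $312^*$-avoiding elements of $B_n$. $\mathrm{half}_k(x)$ is the $k$-th (from the left) maximal substring of consecutive entries of $x$ all of which are $\ge n+1$. -}

module Defs where

open import Data.Nat using (ℕ; zero; suc; _+_; _*_; _∸_; _<_; _≤_; _<?_)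
open import Data.List using (List; []; _∷_; _++_; length; map; upTo; lookup)
open import Data.List.Relation.Binary.Permutation.Propositional using (_↭_)
open import Data.Fin using (Fin; toℕ)
open import Data.Maybe using (Maybe; just; nothing)
open import Data.Product using (_×_; ∃-syntax)
open import Relation.Nullary using (¬_; yes; no)
open import Relation.Binary.PropositionalEquality using (_≡_)

IsPerm : ℕ → List ℕ → Set
IsPerm n x = x ↭ map suc (upTo (2 * n))

-- B_n : signed permutations, x_i + x_{2n+1-i} = 2n+1 (0-based: i + j = 2n-1).
InB : ℕ → List ℕ → Set
InB n x = IsPerm n x ×
  ((i j : Fin (length x)) → toℕ i + toℕ j ≡ 2 * n ∸ 1 →
     lookup x i + lookup x j ≡ suc (2 * n))

Contains312* : ℕ → List ℕ → Set
Contains312* n x = ∃[ i ] ∃[ j ] ∃[ k ]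
  (toℕ {length x} i < toℕ j × toℕ j < toℕ k ×
   lookup x j < lookup x k × lookup x k < lookup x i × suc n ≤ lookup x k)

Tam : ℕ → List ℕ → Set
Tam n x = InB n x × ¬ Contains312* n x

-- maximal substrings of consecutive entries ≥ n+1, from left to right
private
  close : List ℕ → List (List ℕ)
  close []       = []
  close (c ∷ cs) = (c ∷ cs) ∷ []

  go : ℕ → List ℕ → List ℕ → List (List ℕ)
  go n cur []       = close cur
  go n cur (a ∷ xs) with n <? a
  ... | yes _ = go n (cur ++ (a ∷ [])) xs
  ... | no  _ = close cur ++ go n [] xs

halves : ℕ → List ℕ → List (List ℕ)
halves n x = go n [] x

nth : {A : Set} → List A → ℕ → Maybe A
nth []       _       = nothing
nth (a ∷ as) zero    = just a
nth (a ∷ as) (suc i) = nth as i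

-- half_k(x), 1-based; nothing if it does not exist
half : ℕ → List ℕ → ℕ → Maybe (List ℕ)
half n x zero    = nothing
half n x (suc k) = nth (halves n x) k

{-# OPTIONS --safe #-}
module Submission where

-- Consecutive halves are separated by at least one entry c ≤ n, so an entry b of
-- half_{k-1} and an entry a of half_k occur in x as b ⋯ c ⋯ a with c ≤ n < a.
-- If b > a this is a 312* pattern, and b = a is excluded because x is a permutation.

open import Defs
open import Data.Nat using (ℕ; zero; suc; _≤_; _<_; _∸_; _<?_; s≤s; z≤n; _*_)
open import Data.Nat.Properties using (<-cmp; ≮⇒≥; suc-injective; ≤-<-trans)
open import Data.Fin using (Fin; toℕ) renaming (zero to fzero; suc to fsuc)
open import Data.List using (List; []; _∷_; _++_; length; lookup)
open import Data.List.Properties using (++-assoc; ++-identityʳ)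
open import Data.List.Membership.Propositional using (_∈_)
open import Data.List.Relation.Unary.Any using (here; there)
open import Data.List.Relation.Unary.All as All using (All; []; _∷_)
open import Data.List.Relation.Unary.All.Properties using () renaming (++⁺ to All-++⁺)
open import Data.List.Relation.Unary.AllPairs using (AllPairs; []; _∷_)
open import Data.List.Relation.Unary.Unique.Propositional using (Unique)
import Data.List.Relation.Unary.Unique.Propositional.Properties as Unique
import Data.List.Relation.Binary.Permutation.Setoid.Properties as Permutation
open import Data.List.Relation.Binary.Permutation.Propositional using (↭⇒↭ₛ; ↭-sym)
open import Data.List.Relation.Binary.Sublist.Propositional
  using (_⊆_; []; _∷_; _∷ʳ_; ⊆-refl; ⊆-trans; ⊆-reflexive; from∈)
open import Data.List.Relation.Binary.Sublist.Propositional.Properties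
  using (All-resp-⊆; Any-resp-⊆; ++⁺; ++⁺ˡ; ++⁺ʳ)
open import Data.Maybe using (just)
open import Data.Product using (∃-syntax; _×_; _,_)
open import Function using (_∋_)
open import Relation.Nullary using (¬_; yes; no; contradiction)
open import Relation.Binary.Definitions using (tri<; tri≈; tri>)
open import Relation.Binary.PropositionalEquality using (_≡_; refl; sym; subst; subst₂; setoid)

private
  variable
    A : Set
    n : ℕ
    a b : ℕ
    xs ys : List A

-- The accumulating worker go of halves is private to Defs. With-abstracting its
-- initial accumulator [] turns the goal into StartedAt acc (go n acc) for a
-- variable acc; since the meta in start _ is created outside the with, the
-- pattern unification problem ?w acc = go n acc solves ?w := go n.

Worker : Set
Worker = List ℕ → List ℕ → List (List ℕ)

data StartedAt : List ℕ → (List ℕ → List (List ℕ)) → Set where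
  start : (w : Worker) (acc : List ℕ) → StartedAt acc (w acc)

worker : ∀ {acc h} → StartedAt acc h → Worker
worker (start w _) = w

halves-startedAt-[] : ∀ n → StartedAt [] (halves n)
halves-startedAt-[] n with List ℕ ∋ [] | start _
... | acc | start-at = start-at acc

halvesFrom : ℕ → Worker
halvesFrom n = worker (halves-startedAt-[] n)

nth-∈ : ∀ {m} {y : A} → nth xs m ≡ just y → y ∈ xs
nth-∈ {xs = _ ∷ _} {zero}  refl = here refl
nth-∈ {xs = _ ∷ _} {suc m} eq   = there (nth-∈ eq)

reindex : xs ⊆ ys → Fin (length xs) → Fin (length ys)
reindex (_ ∷ʳ τ) i         = fsuc (reindex τ i)
reindex (_ ∷ τ)  fzero     = fzero
reindex (_ ∷ τ)  (fsuc i)  = fsuc (reindex τ i)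

lookup-reindex : (τ : xs ⊆ ys) (i : Fin (length xs)) → lookup ys (reindex τ i) ≡ lookup xs i
lookup-reindex (_ ∷ʳ τ)   i        = lookup-reindex τ i
lookup-reindex (refl ∷ τ) fzero    = refl
lookup-reindex (refl ∷ τ) (fsuc i) = lookup-reindex τ i

reindex-strictlyMonotone : (τ : xs ⊆ ys) {i j : Fin (length xs)} →
                           toℕ i < toℕ j → toℕ (reindex τ i) < toℕ (reindex τ j)
reindex-strictlyMonotone (_ ∷ʳ τ) i<j            = s≤s (reindex-strictlyMonotone τ i<j)
reindex-strictlyMonotone (_ ∷ τ) {fzero} {fsuc j} _ = s≤s z≤n
reindex-strictlyMonotone (_ ∷ τ) {fsuc i} {fsuc j} (s≤s i<j) =
  s≤s (reindex-strictlyMonotone τ i<j)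

AllPairs-resp-⊇ : ∀ {R : A → A → Set} → xs ⊆ ys → AllPairs R ys → AllPairs R xs
AllPairs-resp-⊇ []         []         = []
AllPairs-resp-⊇ (_ ∷ʳ τ)   (_ ∷ rs)   = AllPairs-resp-⊇ τ rs
AllPairs-resp-⊇ (refl ∷ τ) (r ∷ rs)   = All-resp-⊆ τ r ∷ AllPairs-resp-⊇ τ rs

sublist⇒Contains312* : ∀ {u v w x} → u ∷ v ∷ w ∷ [] ⊆ x →
                 v < w → w < u → suc n ≤ w → Contains312* n x
sublist⇒Contains312* τ v<w w<u n<w =
  reindex τ first , reindex τ second , reindex τ third ,
  reindex-strictlyMonotone τ (s≤s z≤n) ,
  reindex-strictlyMonotone τ (s≤s (s≤s z≤n)) ,
  subst₂ _<_ (sym (lookup-reindex τ second)) (sym (lookup-reindex τ third)) v<w ,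
  subst₂ _<_ (sym (lookup-reindex τ third)) (sym (lookup-reindex τ first)) w<u ,
  subst (suc _ ≤_) (sym (lookup-reindex τ third)) n<w
  where
  first second third : Fin 3
  first  = fzero
  second = fsuc fzero
  third  = fsuc (fsuc fzero)

IsPerm⇒Unique : ∀ {x} → IsPerm n x → Unique x
IsPerm⇒Unique {n} x↭ =
  Permutation.Unique-resp-↭ (setoid ℕ) (↭⇒↭ₛ (↭-sym x↭))
    (Unique.map⁺ suc-injective (Unique.upTo⁺ (2 * n)))

halvesFrom-above : ∀ n cur xs → All (n <_) cur → All (All (n <_)) (halvesFrom n cur xs)
halvesFrom-above n []       []       _   = []
halvesFrom-above n (_ ∷ _)  []       al  = al ∷ []
halvesFrom-above n cur      (y ∷ xs) al with n <? y
... | yes n<y = halvesFrom-above n (cur ++ y ∷ []) xs (All-++⁺ al (n<y ∷ []))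
halvesFrom-above n []       (y ∷ xs) al | no _ = halvesFrom-above n [] xs []
halvesFrom-above n (_ ∷ _)  (y ∷ xs) al | no _ = al ∷ halvesFrom-above n [] xs []

halvesFrom-⊆ : ∀ n cur xs → All (_⊆ cur ++ xs) (halvesFrom n cur xs)
halvesFrom-⊆ n []      []       = []
halvesFrom-⊆ n (_ ∷ _) []       = ⊆-reflexive (sym (++-identityʳ _)) ∷ []
halvesFrom-⊆ n cur     (y ∷ xs) with n <? y
... | yes _ = All.map (λ τ → ⊆-trans τ (⊆-reflexive (++-assoc cur (y ∷ []) xs)))
                (halvesFrom-⊆ n (cur ++ y ∷ []) xs)
halvesFrom-⊆ n []      (y ∷ xs) | no _ = All.map (y ∷ʳ_) (halvesFrom-⊆ n [] xs)
halvesFrom-⊆ n cur@(_ ∷ _) (y ∷ xs) | no _ =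
  ++⁺ʳ (y ∷ xs) ⊆-refl ∷ All.map (λ τ → ++⁺ˡ cur (y ∷ʳ τ)) (halvesFrom-⊆ n [] xs)

Separated : ℕ → ℕ → ℕ → List ℕ → Set
Separated n b a xs = ∃[ c ] c ≤ n × b ∷ c ∷ a ∷ [] ⊆ xs

Separated-⊆ : xs ⊆ ys → Separated n b a xs → Separated n b a ys
Separated-⊆ τ (c , c≤n , σ) = c , c≤n , ⊆-trans σ τ

halvesFrom-consecutive-separated :
  ∀ n cur xs m {H H′} → nth (halvesFrom n cur xs) m ≡ just H → nth (halvesFrom n cur xs) (suc m) ≡ just H′ →
  b ∈ H → a ∈ H′ → Separated n b a (cur ++ xs)
halvesFrom-consecutive-separated n []      []       _       ()
halvesFrom-consecutive-separated n (_ ∷ _) []       zero    _  ()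
halvesFrom-consecutive-separated n (_ ∷ _) []       (suc _) ()
halvesFrom-consecutive-separated n cur     (y ∷ xs) m eH eH′ b∈H a∈H′ with n <? y
... | yes _ = Separated-⊆ (⊆-reflexive (++-assoc cur (y ∷ []) xs))
                (halvesFrom-consecutive-separated n (cur ++ y ∷ []) xs m eH eH′ b∈H a∈H′)
halvesFrom-consecutive-separated n [] (y ∷ xs) m eH eH′ b∈H a∈H′ | no _ =
  Separated-⊆ (y ∷ʳ ⊆-refl) (halvesFrom-consecutive-separated n [] xs m eH eH′ b∈H a∈H′)
halvesFrom-consecutive-separated n cur@(_ ∷ _) (y ∷ xs) zero refl eH′ b∈cur a∈H′ | no n≮y =
  y , ≮⇒≥ n≮y , ++⁺ (from∈ b∈cur) (refl ∷ from∈ a∈xs)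
  where
  a∈xs : _ ∈ xs
  a∈xs = Any-resp-⊆ (All.lookup (halvesFrom-⊆ n [] xs) (nth-∈ eH′)) a∈H′
halvesFrom-consecutive-separated n cur@(_ ∷ _) (y ∷ xs) (suc m) eH eH′ b∈H a∈H′ | no _ =
  Separated-⊆ (++⁺ˡ cur (y ∷ʳ ⊆-refl)) (halvesFrom-consecutive-separated n [] xs m eH eH′ b∈H a∈H′)

separated-increasing : ∀ {x} → Unique x → ¬ Contains312* n x →
                       Separated n b a x → n < a → b < a
separated-increasing {b = b} {a} unique avoids312* (c , c≤n , τ) n<a with <-cmp b a
... | tri< b<a _ _ = b<a
... | tri≈ _ b≡a _ with AllPairs-resp-⊇ τ unique
...   | (_ ∷ b≢a ∷ []) ∷ _ = contradiction b≡a b≢a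
separated-increasing unique avoids312* (c , c≤n , τ) n<a | tri> _ _ a<b =
  contradiction (sublist⇒Contains312* τ (≤-<-trans c≤n n<a) a<b n<a) avoids312*

mainTheorem13 : (n : ℕ) (x : List ℕ) → Tam n x →
    (k : ℕ) → 2 ≤ k → (H H′ : List ℕ) →
    half n x k ≡ just H → half n x (k ∸ 1) ≡ just H′ →
    (a : ℕ) → a ∈ H → (b : ℕ) → b ∈ H′ → b < a
mainTheorem13 n x ((x↭ , _) , avoids312*) (suc (suc k)) _ H H′ eH eH′ a a∈H b b∈H′ =
  separated-increasing (IsPerm⇒Unique {n} x↭) avoids312*
    (halvesFrom-consecutive-separated n [] x k eH′ eH b∈H′ a∈H)
    (All.lookup (All.lookup (halvesFrom-above n [] x []) (nth-∈ eH)) a∈H)
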